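{- Let $k\ge3$ be an integer and let $S,S'\subseteq\{4,\dots,k\}$. If $S\neq S'$, then $\mathcal{A}_{k,S}$ and $\mathcal{A}_{k,S'}$ are not isomorphic.
   Context: For $k\ge3$, $\mathcal{A}_k$ is the graph with vertex set $\{1,2,3\}\cup\{i_0,i_1,i_2:4\le i\le k\}$ and edge set consisting of $\{1,2\},\{2,3\},\{1,3\}$; for each $4\le i\le k$ the edges $\{i_0,i_1\},\{i_0,i_2\},\{i_1,2\},\{i_1,3\},\{i_2,1\}$; and $\{i_2,j_1\}$ for all $4\le i<j\le k$. For $S\subseteq\{4,\dots,k\}$, $\mathcal{A}_{k,S}$ is the graph with $V(\mathcal{A}_{k,S})=V(\mathcal{A}_k)$ and $E(\mathcal{A}_{k,S})=E(\mathcal{A}_k)\cup\{\{i_2,2\}:i\in S\}$. -}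

module Defs where

open import Data.Nat using (ℕ; _≤_; _<_)
open import Data.Bool using (Bool; true)
open import Data.Fin using (Fin; zero; suc)
open import Data.Sum using (_⊎_)
open import Data.Empty using (⊥)
open import Data.Product using (Σ; _×_)
open import Relation.Binary.PropositionalEquality using (_≡_)
open import Function.Bundles using (_↔_; Inverse; _⇔_)

data Vtx (k : ℕ) : Set where
  v1 v2 v3 : Vtx k
  node : (i : ℕ) → 4 ≤ i → i ≤ k → Fin 3 → Vtx k

t0 t1 t2 : Fin 3
t0 = zero
t1 = suc zero
t2 = suc (suc zero)

-- Directed listing of the edges of A_k (each edge listed once, in one orientation).
data EdgeA (k : ℕ) : Vtx k → Vtx k → Set where
  e12 : EdgeA k v1 v2
  e23 : EdgeA k v2 v3
  e13 : EdgeA k v1 v3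
  e-i0-i1 : ∀ i p q → EdgeA k (node i p q t0) (node i p q t1)
  e-i0-i2 : ∀ i p q → EdgeA k (node i p q t0) (node i p q t2)
  e-i1-2  : ∀ i p q → EdgeA k (node i p q t1) v2
  e-i1-3  : ∀ i p q → EdgeA k (node i p q t1) v3
  e-i2-1  : ∀ i p q → EdgeA k (node i p q t2) v1
  e-i2-j1 : ∀ i p q j p' q' → i < j → EdgeA k (node i p q t2) (node j p' q' t1)

-- Directed listing of the edges of A_{k,S}; S ⊆ {4..k} is given by its
-- characteristic function (only its values on 4..k matter).
data EdgeAS (k : ℕ) (S : ℕ → Bool) : Vtx k → Vtx k → Set where
  base : ∀ {u v} → EdgeA k u v → EdgeAS k S u v
  e-i2-2 : ∀ i p q → S i ≡ true → EdgeAS k S (node i p q t2) v2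

Adj : (k : ℕ) (S : ℕ → Bool) → Vtx k → Vtx k → Set
Adj k S u v = EdgeAS k S u v ⊎ EdgeAS k S v u

Isomorphic : (k : ℕ) (S S' : ℕ → Bool) → Set
Isomorphic k S S' =
  Σ (Vtx k ↔ Vtx k) λ f →
    ∀ u v → Adj k S u v ⇔ Adj k S' (Inverse.to f u) (Inverse.to f v)

DifferOn : (k : ℕ) (S S' : ℕ → Bool) → Set
DifferOn k S S' = Σ ℕ λ i → (4 ≤ i × i ≤ k) × (S i ≡ S' i → ⊥)

-- An isomorphism preserves, for each d, the number of vertices of degree d. In A_{k,S} only the
-- degrees of the vertices i₂ depend on S: i₂ has degree (k − i + 2) + [i ∈ S]. Let m be the largest
-- index at which S and S′ differ and let d be the degree of m₂ in A_k. Vertex 2 and the vertices i₂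
-- with i < m have degree larger than d in both graphs, while every other vertex except m₂ has the
-- same degree in both graphs. So the two counts of degree-d vertices differ exactly by whether m₂
-- has degree d, i.e. by whether m ∉ S, and equality of the counts forces S m = S′ m.
module Submission where

open import Defs
open import Data.Nat using (ℕ; _≤_)
open import Data.Bool using (Bool)
open import Relation.Nullary using (¬_)

open import Algebra.Bundles using (CommutativeMonoid)
open import Data.Bool using (true; false; _∨_; _∧_; not; T)
import Data.Bool as Bool
open import Data.Bool.Properties using (T-∨; T-≡; ⇔→≡; ∨-commutativeMonoid; not-injective)
open import Algebra.Properties.CommutativeSemigroup (CommutativeMonoid.commutativeSemigroup ∨-commutativeMonoid)
  using (interchange)
open import Data.Fin.Patterns using (0F; 1F; 2F)
open import Data.List using (List; []; _∷_; _++_; map; concatMap; upTo)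
open import Data.List.Membership.Propositional using (_∈_; lose)
open import Data.List.Membership.Propositional.Properties using (∈-map⁺; ∈-upTo⁺; ∈-concatMap⁺; ∈-concatMap⁻)
open import Data.List.Membership.Propositional.Properties.WithK using (unique∧set⇒bag)
open import Data.List.Properties using (map-++; map-∘; map-cong; map-cong-local)
open import Data.List.Relation.Binary.BagAndSetEquality using (∼bag⇒↭)
open import Data.List.Relation.Binary.Disjoint.Propositional using (Disjoint)
open import Data.List.Relation.Binary.Permutation.Propositional using (_↭_)
import Data.List.Relation.Binary.Permutation.Propositional.Properties as ↭
open import Data.List.Relation.Unary.All as All using (All; []; _∷_)
import Data.List.Relation.Unary.All.Properties as All
import Data.List.Relation.Unary.AllPairs as AllPairs
import Data.List.Relation.Unary.AllPairs.Properties as AllPairs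
open import Data.List.Relation.Unary.Any using (here; there; satisfied)
open import Data.List.Relation.Unary.Unique.Propositional using (Unique; []; _∷_)
import Data.List.Relation.Unary.Unique.Propositional.Properties as Unique
open import Data.Nat using (suc; _+_; _<_; s≤s; z≤n; _≟_; _<?_; _≤?_)
open import Data.Nat.ListAction using (sum)
open import Data.Nat.ListAction.Properties using (sum-++; sum-↭)
open import Data.Nat.Properties
open import Data.Nat.Tactic.RingSolver using (solve-∀)
open import Data.Product using (∃-syntax; _×_; _,_; proj₂)
open import Data.Sum using (_⊎_; inj₁; inj₂)
open import Data.Sum.Function.Propositional using (_⊎-⇔_)
open import Function using (_∘_; _⇔_; _↔_; mk⇔; Equivalence; Inverse)
open import Function.Properties.Equivalence using () renaming (trans to ⇔-trans; sym to ⇔-sym)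
open import Relation.Binary.Definitions using (tri<; tri≈; tri>)
open import Relation.Binary.PropositionalEquality
open import Relation.Nullary using (¬?; yes; no; contradiction)
open import Relation.Nullary.Decidable using (⌊_⌋; toWitness; fromWitness; _×-dec_; dec-yes; dec-no; decidable-stable)
open import Relation.Unary using (Decidable)

indicator : Bool → ℕ
indicator true  = 1
indicator false = 0

indicator-mono : ∀ {a b} → (T a → T b) → indicator a ≤ indicator b
indicator-mono {false}         _   = z≤n
indicator-mono {true}  {true}  _   = ≤-refl
indicator-mono {true}  {false} a⇒b = contradiction _ a⇒b

indicator-< : ∀ {a b} → ¬ T a → T b → indicator a < indicator b
indicator-< {false} {true} _ _ = s≤s z≤n
indicator-< {true}         ¬a _ = contradiction _ ¬a

indicator-injective : ∀ {a b} → indicator a ≡ indicator b → a ≡ b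
indicator-injective {false} {false} _ = refl
indicator-injective {true}  {true}  _ = refl

T-injective : ∀ {a b} → T a ⇔ T b → a ≡ b
T-injective a⇔b = ⇔→≡ (⇔-trans (⇔-sym T-≡) (⇔-trans a⇔b T-≡))

+-indicator-≟ : ∀ d b → ⌊ d + indicator b ≟ d ⌋ ≡ not b
+-indicator-≟ d true  = cong ⌊_⌋ (dec-no (d + 1 ≟ d) (m+1+n≢m d))
+-indicator-≟ d false = cong ⌊_⌋ (proj₂ (dec-yes (d + 0 ≟ d) (+-identityʳ d)))

module _ {A : Set} {g h : A → ℕ} where

  sum-map-differ-at : ∀ {xs x} → Unique xs → x ∈ xs → (∀ y → y ≢ x → g y ≡ h y) →
                      sum (map g xs) + h x ≡ sum (map h xs) + g x
  sum-map-differ-at {x ∷ xs} (x∉xs ∷ _) (here refl) agree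
    rewrite map-cong-local (All.map (λ x≢y → agree _ (x≢y ∘ sym)) x∉xs) =
      swap (g x) (sum (map h xs)) (h x)
    where
    swap : ∀ a s b → a + s + b ≡ b + s + a
    swap = solve-∀
  sum-map-differ-at {y ∷ xs} {x} (y∉xs ∷ xs!) (there x∈xs) agree = begin
    g y + sum (map g xs) + h x   ≡⟨ +-assoc (g y) _ _ ⟩
    g y + (sum (map g xs) + h x) ≡⟨ cong₂ _+_ (agree y (All.lookup y∉xs x∈xs)) (sum-map-differ-at xs! x∈xs agree) ⟩
    h y + (sum (map h xs) + g x) ≡⟨ +-assoc (h y) _ _ ⟨
    h y + sum (map h xs) + g x   ∎
    where open ≡-Reasoning

  sum-map-mono : (∀ x → g x ≤ h x) → ∀ xs → sum (map g xs) ≤ sum (map h xs)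
  sum-map-mono g≤h []       = ≤-refl
  sum-map-mono g≤h (x ∷ xs) = +-mono-≤ (g≤h x) (sum-map-mono g≤h xs)

  sum-map-< : (∀ x → g x ≤ h x) → ∀ {x xs} → x ∈ xs → g x < h x → sum (map g xs) < sum (map h xs)
  sum-map-< g≤h {xs = _ ∷ xs} (here refl) gx<hx = +-mono-<-≤ gx<hx (sum-map-mono g≤h xs)
  sum-map-< g≤h {xs = y ∷ _}  (there x∈xs) gx<hx = +-mono-≤-< (g≤h y) (sum-map-< g≤h x∈xs gx<hx)

sum-map-concatMap : ∀ {A B : Set} (g : B → ℕ) (f : A → List B) xs →
  sum (map g (concatMap f xs)) ≡ sum (map (λ x → sum (map g (f x))) xs)
sum-map-concatMap g f []       = refl
sum-map-concatMap g f (x ∷ xs) = begin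
  sum (map g (f x ++ concatMap f xs))                        ≡⟨ cong sum (map-++ g (f x) _) ⟩
  sum (map g (f x) ++ map g (concatMap f xs))                ≡⟨ sum-++ (map g (f x)) _ ⟩
  sum (map g (f x)) + sum (map g (concatMap f xs))           ≡⟨ cong (sum (map g (f x)) +_) (sum-map-concatMap g f xs) ⟩
  sum (map g (f x)) + sum (map (λ x → sum (map g (f x))) xs) ∎
  where open ≡-Reasoning

module _ {A : Set} {xs : List A} (xs! : Unique xs) (∈xs : ∀ x → x ∈ xs) (f : A ↔ A) where
  open Inverse f

  map-bijection-↭ : map to xs ↭ xs
  map-bijection-↭ = ∼bag⇒↭ (unique∧set⇒bag (Unique.map⁺ to-injective xs!) xs!
    (mk⇔ (λ _ → ∈xs _) (λ _ → subst (_∈ map to xs) (strictlyInverseˡ _) (∈-map⁺ to (∈xs (from _))))))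
    where
    to-injective : ∀ {x y} → to x ≡ to y → x ≡ y
    to-injective {x} {y} e = trans (sym (strictlyInverseʳ x)) (trans (cong from e) (strictlyInverseʳ y))

  sum-map-bijection : ∀ g → sum (map (g ∘ to) xs) ≡ sum (map g xs)
  sum-map-bijection g = trans (cong sum (map-∘ xs)) (sum-↭ (↭.map⁺ g map-bijection-↭))

module _ {P : ℕ → Set} (P? : Decidable P) where

  last-satisfying : ∀ {i} n → i ≤ n → P i →
    ∃[ m ] i ≤ m × m ≤ n × P m × (∀ {j} → m < j → j ≤ n → ¬ P j)
  last-satisfying n i≤n Pi with P? n | m≤n⇒m<n∨m≡n i≤n
  ... | yes Pn | _ = n , i≤n , ≤-refl , Pn , λ n<j j≤n → contradiction j≤n (<⇒≱ n<j)
  ... | no ¬Pn | inj₂ refl = contradiction Pi ¬Pn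
  last-satisfying (suc n) _ Pi | no ¬Pn | inj₁ (s≤s i≤n)
    with m , i≤m , m≤n , Pm , above ← last-satisfying n i≤n Pi =
      m , i≤m , m≤n⇒m≤1+n m≤n , Pm , above′
    where
    above′ : ∀ {j} → m < j → j ≤ suc n → ¬ P j
    above′ m<j j≤1+n with m≤n⇒m<n∨m≡n j≤1+n
    ... | inj₁ (s≤s j≤n) = above m<j j≤n
    ... | inj₂ refl      = ¬Pn

module _ {k : ℕ} where

  node-irrelevant : ∀ {i t} {p p′ : 4 ≤ i} {q q′ : i ≤ k} → node {k} i p q t ≡ node i p′ q′ t
  node-irrelevant = cong₂ (λ p q → node _ p q _) (≤-irrelevant _ _) (≤-irrelevant _ _)

  arc : Vtx k → Vtx k → Bool
  arc v1 v2 = true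
  arc v1 v3 = true
  arc v2 v3 = true
  arc (node i _ _ 0F) (node j _ _ 1F) = ⌊ i ≟ j ⌋
  arc (node i _ _ 0F) (node j _ _ 2F) = ⌊ i ≟ j ⌋
  arc (node _ _ _ 1F) v2 = true
  arc (node _ _ _ 1F) v3 = true
  arc (node _ _ _ 2F) v1 = true
  arc (node i _ _ 2F) (node j _ _ 1F) = ⌊ i <? j ⌋
  arc _ _ = false

  arc-complete : ∀ {u w} → EdgeA k u w → T (arc u w)
  arc-complete e12 = _
  arc-complete e23 = _
  arc-complete e13 = _
  arc-complete (e-i0-i1 i p q) = fromWitness refl
  arc-complete (e-i0-i2 i p q) = fromWitness refl
  arc-complete (e-i1-2 i p q) = _
  arc-complete (e-i1-3 i p q) = _
  arc-complete (e-i2-1 i p q) = _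
  arc-complete (e-i2-j1 i p q j p′ q′ i<j) = fromWitness i<j

  -- The omitted clauses are those in which T (arc u w) reduces to the empty type.
  arc-sound : ∀ u w → T (arc u w) → EdgeA k u w
  arc-sound v1 v2 _ = e12
  arc-sound v1 v3 _ = e13
  arc-sound v2 v3 _ = e23
  arc-sound (node i p q 0F) (node j p′ q′ 1F) i≡j with refl ← toWitness i≡j =
    subst (EdgeA k _) node-irrelevant (e-i0-i1 i p q)
  arc-sound (node i p q 0F) (node j p′ q′ 2F) i≡j with refl ← toWitness i≡j =
    subst (EdgeA k _) node-irrelevant (e-i0-i2 i p q)
  arc-sound (node i p q 1F) v2 _ = e-i1-2 i p q
  arc-sound (node i p q 1F) v3 _ = e-i1-3 i p q
  arc-sound (node i p q 2F) v1 _ = e-i2-1 i p q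
  arc-sound (node i p q 2F) (node j p′ q′ 1F) i<j = e-i2-j1 i p q j p′ q′ (toWitness i<j)

  adjA : Vtx k → Vtx k → Bool
  adjA u w = arc u w ∨ arc w u

  isV2 : Vtx k → Bool
  isV2 v2 = true
  isV2 _  = false

  inS₂ : (ℕ → Bool) → Vtx k → Bool
  inS₂ S (node i _ _ 2F) = S i
  inS₂ S _               = false

  extra : (ℕ → Bool) → Vtx k → Vtx k → Bool
  extra S u w = (isV2 w ∧ inS₂ S u) ∨ (isV2 u ∧ inS₂ S w)

  adj : (ℕ → Bool) → Vtx k → Vtx k → Bool
  adj S u w = extra S u w ∨ adjA u w

  edgeAS⇔ : ∀ {S} u w → EdgeAS k S u w ⇔ T ((isV2 w ∧ inS₂ S u) ∨ arc u w)
  edgeAS⇔ {S} u w = mk⇔ complete (sound u w ∘ Equivalence.to T-∨)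
    where
    complete : ∀ {u w} → EdgeAS k S u w → T ((isV2 w ∧ inS₂ S u) ∨ arc u w)
    complete (base e)          = Equivalence.from T-∨ (inj₂ (arc-complete e))
    complete (e-i2-2 i p q Si) = Equivalence.from T-∨ (inj₁ (Equivalence.from T-≡ Si))
    sound : ∀ u w → T (isV2 w ∧ inS₂ S u) ⊎ T (arc u w) → EdgeAS k S u w
    sound u w (inj₂ a) = base (arc-sound u w a)
    sound (node i p q 2F) v2 (inj₁ Si) = e-i2-2 i p q (Equivalence.to T-≡ Si)

  Adj⇔adj : ∀ {S} u w → Adj k S u w ⇔ T (adj S u w)
  Adj⇔adj {S} u w =
    subst (λ b → Adj k S u w ⇔ T b) (interchange (isV2 w ∧ inS₂ S u) (arc u w) (isV2 u ∧ inS₂ S w) (arc w u))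
      (⇔-trans (edgeAS⇔ u w ⊎-⇔ edgeAS⇔ w u) (⇔-sym T-∨))

  layer : (j : ℕ) → 4 ≤ j → j ≤ k → List (Vtx k)
  layer j p q = node j p q 0F ∷ node j p q 1F ∷ node j p q 2F ∷ []

  -- Empty unless 4 ≤ j ≤ k, so that all nodes are listed by letting j run over upTo (suc k).
  block : ℕ → List (Vtx k)
  block j with 4 ≤? j ×-dec j ≤? k
  ... | yes (p , q) = layer j p q
  ... | no _        = []

  nodes : List (Vtx k)
  nodes = concatMap block (upTo (suc k))

  vertices : List (Vtx k)
  vertices = v1 ∷ v2 ∷ v3 ∷ nodes

  ∈-block⁻ : ∀ {w j} → w ∈ block j → ∃[ p ] ∃[ q ] ∃[ t ] w ≡ node j p q t
  ∈-block⁻ {j = j} w∈ with 4 ≤? j ×-dec j ≤? k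
  ∈-block⁻ (here refl)                 | yes (p , q) = p , q , 0F , refl
  ∈-block⁻ (there (here refl))         | yes (p , q) = p , q , 1F , refl
  ∈-block⁻ (there (there (here refl))) | yes (p , q) = p , q , 2F , refl

  ∈-block : ∀ {j} p q t → node j p q t ∈ block j
  ∈-block {j} p q t with 4 ≤? j ×-dec j ≤? k
  ... | no ¬pq = contradiction (p , q) ¬pq
  ... | yes (p′ , q′) with t
  ...   | 0F = here node-irrelevant
  ...   | 1F = there (here node-irrelevant)
  ...   | 2F = there (there (here node-irrelevant))

  ∈-vertices : ∀ v → v ∈ vertices
  ∈-vertices v1 = here refl
  ∈-vertices v2 = there (here refl)
  ∈-vertices v3 = there (there (here refl))
  ∈-vertices (node i p q t) =
    there (there (there (∈-concatMap⁺ block (lose (∈-upTo⁺ (s≤s q)) (∈-block p q t)))))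

  block-unique : ∀ j → Unique (block j)
  block-unique j with 4 ≤? j ×-dec j ≤? k
  ... | yes _ = ((λ ()) ∷ (λ ()) ∷ []) ∷ ((λ ()) ∷ []) ∷ [] ∷ []
  ... | no _  = []

  block-disjoint : ∀ {i j} → i ≢ j → Disjoint (block i) (block j)
  block-disjoint i≢j (w∈i , w∈j)
    with _ , _ , _ , refl ← ∈-block⁻ w∈i | _ , _ , _ , e ← ∈-block⁻ w∈j = i≢j (index-≡ e)
    where
    index-≡ : ∀ {i j p q t p′ q′ t′} → node {k} i p q t ≡ node j p′ q′ t′ → i ≡ j
    index-≡ refl = refl

  nodes-unique : ∀ {js} → Unique js → Unique (concatMap block js)
  nodes-unique js! = Unique.concat⁺ (All.map⁺ (All.universal block-unique _))
    (AllPairs.map⁺ (AllPairs.map block-disjoint js!))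

  corner∉nodes : ∀ {c} → (∀ {j p q t} → c ≢ node j p q t) → All (c ≢_) nodes
  corner∉nodes c≢node = All.tabulate λ w∈ c≡w →
    let _ , w∈j = satisfied (∈-concatMap⁻ block {xs = upTo (suc k)} w∈)
        _ , _ , _ , w≡node = ∈-block⁻ w∈j
    in c≢node (trans c≡w w≡node)

  vertices-unique : Unique vertices
  vertices-unique =
    ((λ ()) ∷ (λ ()) ∷ corner∉nodes (λ ())) ∷
    ((λ ()) ∷ corner∉nodes (λ ())) ∷
    corner∉nodes (λ ()) ∷
    nodes-unique (Unique.upTo⁺ (suc k))

  degree : (ℕ → Bool) → Vtx k → ℕ
  degree S v = sum (map (indicator ∘ adj S v) vertices)

  degreeA : Vtx k → ℕ
  degreeA v = sum (map (indicator ∘ adjA v) vertices)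

  isV2-≢ : ∀ {v} → v ≢ v2 → isV2 v ≡ false
  isV2-≢ {v1}           _    = refl
  isV2-≢ {v2}           v≢v2 = contradiction refl v≢v2
  isV2-≢ {v3}           _    = refl
  isV2-≢ {node _ _ _ _} _    = refl

  extra-off-v2 : ∀ S {u w} → u ≢ v2 → w ≢ v2 → extra S u w ≡ false
  extra-off-v2 S {u} {w} u≢v2 w≢v2 =
    cong₂ (λ a b → (a ∧ inS₂ S u) ∨ (b ∧ inS₂ S w)) (isV2-≢ w≢v2) (isV2-≢ u≢v2)

  adj-to-v2 : ∀ S {v} → v ≢ v2 → indicator (adj S v v2) ≡ indicator (adjA v v2) + indicator (inS₂ S v)
  adj-to-v2 S {v1}           _    = refl
  adj-to-v2 S {v2}           v≢v2 = contradiction refl v≢v2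
  adj-to-v2 S {v3}           _    = refl
  adj-to-v2 S {node _ _ _ 0F} _    = refl
  adj-to-v2 S {node _ _ _ 1F} _    = refl
  adj-to-v2 S {node i _ _ 2F} _ with S i
  ... | true  = refl
  ... | false = refl

  degree≡degreeA+inS₂ : ∀ S v → v ≢ v2 → degree S v ≡ degreeA v + indicator (inS₂ S v)
  degree≡degreeA+inS₂ S v v≢v2 = +-cancelʳ-≡ (indicator (adjA v v2)) _ _ (begin
    degree S v + indicator (adjA v v2)                         ≡⟨ sum-map-differ-at vertices-unique (∈-vertices v2) agree ⟩
    degreeA v + indicator (adj S v v2)                         ≡⟨ cong (degreeA v +_) (adj-to-v2 S v≢v2) ⟩
    degreeA v + (indicator (adjA v v2) + indicator (inS₂ S v)) ≡⟨ cong (degreeA v +_) (+-comm (indicator (adjA v v2)) _) ⟩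
    degreeA v + (indicator (inS₂ S v) + indicator (adjA v v2)) ≡⟨ +-assoc (degreeA v) _ _ ⟨
    degreeA v + indicator (inS₂ S v) + indicator (adjA v v2)   ∎)
    where
    open ≡-Reasoning
    agree : ∀ w → w ≢ v2 → indicator (adj S v w) ≡ indicator (adjA v w)
    agree w w≢v2 = cong (λ b → indicator (b ∨ adjA v w)) (extra-off-v2 S v≢v2 w≢v2)

  layers : (Vtx k → ℕ) → ℕ
  layers g = sum (map (λ j → sum (map g (block j))) (upTo (suc k)))

  sum-vertices : ∀ g → sum (map g vertices) ≡ g v1 + (g v2 + (g v3 + layers g))
  sum-vertices g = cong (λ s → g v1 + (g v2 + (g v3 + s))) (sum-map-concatMap g block (upTo (suc k)))

  block-in-range : ∀ {j} p q → block j ≡ layer j p q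
  block-in-range {j} p q with 4 ≤? j ×-dec j ≤? k
  ... | yes (p′ , q′) = cong₂ (layer j) (≤-irrelevant p′ p) (≤-irrelevant q′ q)
  ... | no ¬pq        = contradiction (p , q) ¬pq

  module _ {g h : Vtx k → ℕ} (g≤h : ∀ {j} p q → sum (map g (layer j p q)) ≤ sum (map h (layer j p q))) where

    block-sum-mono : ∀ j → sum (map g (block j)) ≤ sum (map h (block j))
    block-sum-mono j with 4 ≤? j ×-dec j ≤? k
    ... | yes (p , q) = g≤h p q
    ... | no _        = ≤-refl

    layers-mono : layers g ≤ layers h
    layers-mono = sum-map-mono block-sum-mono (upTo (suc k))

    layers-< : ∀ {i} p q → sum (map g (layer i p q)) < sum (map h (layer i p q)) → layers g < layers h
    layers-< p q g<h = sum-map-< block-sum-mono (∈-upTo⁺ (s≤s q))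
      (subst (λ b → sum (map g b) < sum (map h b)) (sym (block-in-range p q)) g<h)

  degreeA-in : Vtx k → (j : ℕ) → 4 ≤ j → j ≤ k → ℕ
  degreeA-in v j p q = sum (map (indicator ∘ adjA v) (layer j p q))

  degreeA-in-i2 : ∀ {i} p q {j} p′ q′ → degreeA-in (node i p q 2F) j p′ q′ ≡ indicator ⌊ i ≤? j ⌋
  degreeA-in-i2 {i} _ _ {j} _ _ with <-cmp i j
  ... | tri< i<j i≢j _
    rewrite dec-no (j ≟ i) (i≢j ∘ sym) | proj₂ (dec-yes (i <? j) i<j) | proj₂ (dec-yes (i ≤? j) (<⇒≤ i<j)) = refl
  ... | tri≈ _ refl _
    rewrite proj₂ (dec-yes (i ≟ i) refl) | dec-no (i <? i) (<-irrefl refl) | proj₂ (dec-yes (i ≤? i) ≤-refl) = refl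
  ... | tri> _ i≢j j<i
    rewrite dec-no (j ≟ i) (i≢j ∘ sym) | dec-no (i <? j) (<⇒≯ j<i) | dec-no (i ≤? j) (<⇒≱ j<i) = refl

  degreeA-i2<v2 : ∀ {m} p q → degreeA (node m p q 2F) < degreeA v2
  degreeA-i2<v2 {m} p q = begin-strict
    degreeA m₂                                ≡⟨ sum-vertices (indicator ∘ adjA m₂) ⟩
    1 + layers (indicator ∘ adjA m₂)          <⟨ s≤s (s≤s (layers-mono {indicator ∘ adjA m₂} at-most-one)) ⟩
    2 + layers (indicator ∘ adjA v2)          ≡⟨ sum-vertices (indicator ∘ adjA v2) ⟨
    degreeA v2                                ∎
    where
    open ≤-Reasoning
    m₂ = node m p q 2F
    at-most-one : ∀ {j} p′ q′ → degreeA-in m₂ j p′ q′ ≤ degreeA-in v2 j p′ q′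
    at-most-one p′ q′ = subst (_≤ 1) (sym (degreeA-in-i2 p q p′ q′)) (indicator-mono _)

  degreeA-i2-decreasing : ∀ {i m} p q p′ q′ → i < m → degreeA (node m p′ q′ 2F) < degreeA (node i p q 2F)
  degreeA-i2-decreasing {i} {m} p q p′ q′ i<m = begin-strict
    degreeA m₂                                ≡⟨ sum-vertices (indicator ∘ adjA m₂) ⟩
    1 + layers (indicator ∘ adjA m₂)          <⟨ s≤s (layers-< {indicator ∘ adjA m₂} ≤-layer p q <-layer) ⟩
    1 + layers (indicator ∘ adjA i₂)          ≡⟨ sum-vertices (indicator ∘ adjA i₂) ⟨
    degreeA i₂                                ∎
    where
    open ≤-Reasoning
    m₂ = node m p′ q′ 2F
    i₂ = node i p q 2F
    ≤-layer : ∀ {j} p″ q″ → degreeA-in m₂ j p″ q″ ≤ degreeA-in i₂ j p″ q″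
    ≤-layer p″ q″ = subst₂ _≤_ (sym (degreeA-in-i2 p′ q′ p″ q″)) (sym (degreeA-in-i2 p q p″ q″))
      (indicator-mono (fromWitness ∘ ≤-trans (<⇒≤ i<m) ∘ toWitness))
    <-layer : degreeA-in m₂ i p q < degreeA-in i₂ i p q
    <-layer = subst₂ _<_ (sym (degreeA-in-i2 p′ q′ p q)) (sym (degreeA-in-i2 p q p q))
      (indicator-< (<⇒≱ i<m ∘ toWitness) (fromWitness ≤-refl))

  degreeA≤degree : ∀ S v → degreeA v ≤ degree S v
  degreeA≤degree S v =
    sum-map-mono (λ w → indicator-mono (Equivalence.from (T-∨ {extra S v w}) ∘ inj₂)) vertices

  hasDegree : (ℕ → Bool) → ℕ → Vtx k → Bool
  hasDegree S d v = ⌊ degree S v ≟ d ⌋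

  module _ {S S′ : ℕ → Bool} (f : Vtx k ↔ Vtx k)
           (iso : ∀ u v → Adj k S u v ⇔ Adj k S′ (Inverse.to f u) (Inverse.to f v)) where
    open Inverse f using (to)

    adj-preserved : ∀ u w → adj S′ (to u) (to w) ≡ adj S u w
    adj-preserved u w =
      T-injective (⇔-trans (⇔-sym (Adj⇔adj (to u) (to w))) (⇔-trans (⇔-sym (iso u w)) (Adj⇔adj u w)))

    degree-preserved : ∀ v → degree S′ (to v) ≡ degree S v
    degree-preserved v = begin
      degree S′ (to v)
        ≡⟨ sum-map-bijection vertices-unique ∈-vertices f (indicator ∘ adj S′ (to v)) ⟨
      sum (map (indicator ∘ adj S′ (to v) ∘ to) vertices)
        ≡⟨ cong sum (map-cong (cong indicator ∘ adj-preserved v) vertices) ⟩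
      degree S v ∎
      where open ≡-Reasoning

    count-preserved : ∀ d → sum (map (indicator ∘ hasDegree S d) vertices)
                          ≡ sum (map (indicator ∘ hasDegree S′ d) vertices)
    count-preserved d = begin
      sum (map (indicator ∘ hasDegree S d) vertices)
        ≡⟨ cong sum (map-cong (cong (λ n → indicator ⌊ n ≟ d ⌋) ∘ sym ∘ degree-preserved) vertices) ⟩
      sum (map (indicator ∘ hasDegree S′ d ∘ to) vertices)
        ≡⟨ sum-map-bijection vertices-unique ∈-vertices f (indicator ∘ hasDegree S′ d) ⟩
      sum (map (indicator ∘ hasDegree S′ d) vertices) ∎
      where open ≡-Reasoning

  module _ {S S′ : ℕ → Bool} {m} (p : 4 ≤ m) (q : m ≤ k) (above : ∀ {j} → m < j → j ≤ k → S j ≡ S′ j) where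
    private
      m₂ = node m p q 2F
      d  = degreeA m₂

    same-inS₂⇒same-degree : ∀ v → v ≢ v2 → inS₂ S v ≡ inS₂ S′ v → degree S v ≡ degree S′ v
    same-inS₂⇒same-degree v v≢v2 e = begin
      degree S v                        ≡⟨ degree≡degreeA+inS₂ S v v≢v2 ⟩
      degreeA v + indicator (inS₂ S v)  ≡⟨ cong (λ b → degreeA v + indicator b) e ⟩
      degreeA v + indicator (inS₂ S′ v) ≡⟨ degree≡degreeA+inS₂ S′ v v≢v2 ⟨
      degree S′ v                       ∎
      where open ≡-Reasoning

    same-degree-or-large : ∀ v → v ≢ m₂ → degree S v ≡ degree S′ v ⊎ d < degreeA v
    same-degree-or-large v@v1              _ = inj₁ (same-inS₂⇒same-degree v (λ ()) refl)
    same-degree-or-large v2                _ = inj₂ (degreeA-i2<v2 p q)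
    same-degree-or-large v@v3              _ = inj₁ (same-inS₂⇒same-degree v (λ ()) refl)
    same-degree-or-large v@(node _ _ _ 0F) _ = inj₁ (same-inS₂⇒same-degree v (λ ()) refl)
    same-degree-or-large v@(node _ _ _ 1F) _ = inj₁ (same-inS₂⇒same-degree v (λ ()) refl)
    same-degree-or-large v@(node i p′ q′ 2F) v≢m₂ with <-cmp i m
    ... | tri< i<m _ _  = inj₂ (degreeA-i2-decreasing p′ q′ p q i<m)
    ... | tri≈ _ refl _ = contradiction node-irrelevant v≢m₂
    ... | tri> _ _ m<i  = inj₁ (same-inS₂⇒same-degree v (λ ()) (above m<i q′))

    hasDegree-agree : ∀ v → v ≢ m₂ → hasDegree S d v ≡ hasDegree S′ d v
    hasDegree-agree v v≢m₂ with same-degree-or-large v v≢m₂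
    ... | inj₁ e   = cong (λ n → ⌊ n ≟ d ⌋) e
    ... | inj₂ d<v = trans (too-large S) (sym (too-large S′))
      where
      too-large : ∀ T → hasDegree T d v ≡ false
      too-large T = cong ⌊_⌋ (dec-no (degree T v ≟ d) (<⇒≢ (<-≤-trans d<v (degreeA≤degree T v)) ∘ sym))

    hasDegree-m₂ : ∀ T → hasDegree T d m₂ ≡ not (T m)
    hasDegree-m₂ T =
      trans (cong (λ n → ⌊ n ≟ d ⌋) (degree≡degreeA+inS₂ T m₂ (λ ()))) (+-indicator-≟ d (T m))

    isomorphic⇒agree-at : Isomorphic k S S′ → S m ≡ S′ m
    isomorphic⇒agree-at (f , iso) = not-injective (begin
      not (S m)          ≡⟨ hasDegree-m₂ S ⟨
      hasDegree S d m₂   ≡⟨ indicator-injective (+-cancelˡ-≡ _ _ _ count-at-m₂) ⟨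
      hasDegree S′ d m₂  ≡⟨ hasDegree-m₂ S′ ⟩
      not (S′ m)         ∎)
      where
      open ≡-Reasoning
      g = indicator ∘ hasDegree S d
      h = indicator ∘ hasDegree S′ d
      count-at-m₂ : sum (map h vertices) + h m₂ ≡ sum (map h vertices) + g m₂
      count-at-m₂ = trans (cong (_+ h m₂) (sym (count-preserved f iso d)))
        (sum-map-differ-at {g = g} {h} vertices-unique (∈-vertices m₂)
          (λ v → cong indicator ∘ hasDegree-agree v))

lemma4p3 : (k : ℕ) → 3 ≤ k → (S S' : ℕ → Bool) →
    DifferOn k S S' → ¬ Isomorphic k S S'
lemma4p3 k _ S S′ (i , (4≤i , i≤k) , Si≢S′i) S≅S′
  with m , i≤m , m≤k , Sm≢S′m , above ← last-satisfying (λ j → ¬? (S j Bool.≟ S′ j)) k i≤k Si≢S′i =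
    Sm≢S′m (isomorphic⇒agree-at (≤-trans 4≤i i≤m) m≤k agree-above S≅S′)
  where
  agree-above : ∀ {j} → m < j → j ≤ k → S j ≡ S′ j
  agree-above m<j j≤k = decidable-stable (S _ Bool.≟ S′ _) (above m<j j≤k)
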